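{- Let $G=Q_n(X)$ be a daisy cube and let $ab\in E(G)$ with $a=a_1\dots a_{i-1}0a_{i+1}\dots a_n$ and $b=a_1\dots a_{i-1}1a_{i+1}\dots a_n$ for some position $i$. Then $\langle U_{ab}\rangle$ is a $\le$-subgraph of $G$.
   Context: $B=\{0,1\}$; $Q_n$ has vertex set $B^n$ (binary strings of length $n$), two strings adjacent iff they differ in exactly one position. For $u,v\in B^n$ write $u\le v$ if $u_i\le v_i$ for all $i$. For $X\subseteq B^n$ the daisy cube $Q_n(X)$ is the subgraph of $Q_n$ induced by $\{u: u\le x\text{ for some } x\in X\}$. An induced subgraph $H$ of a daisy cube $G$ is a $\le$-subgraph if $V(H)=\{u\in V(G): u\le v\text{ for some } v\in V(H)\}$. For an edge $ab$ of $G$ (distances in $G$): $W_{ab}=\{w: d(a,w)<d(b,w)\}$, $W_{ba}=\{w: d(b,w)<d(a,w)\}$, $F_{ab}=\{xy\in E(G): x\in W_{ab}, y\in W_{ba}\}$, and $U_{ab}$ is the set of vertices of $W_{ab}$ that are endpoints of edges in $F_{ab}$. $\langle S\rangle$ is the subgraph of $G$ induced by $S$. -}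

module Defs where

open import Data.Nat using (ℕ; zero; suc; _<_)
open import Data.Bool using (Bool; true; false)
import Data.Bool as B
open import Data.Fin using (Fin)
open import Data.Vec using (Vec; []; _∷_; lookup; _[_]≔_)
open import Data.Vec.Relation.Binary.Pointwise.Inductive using (Pointwise)
open import Data.List using (List)
open import Data.List.Membership.Propositional using (_∈_)
open import Data.Product using (Σ; _×_; ∃; ∃-syntax)
open import Relation.Binary.PropositionalEquality using (_≡_)
open import Function.Bundles using (_⇔_)

Word : ℕ → Set
Word n = Vec Bool n

_≼_ : ∀ {n} → Word n → Word n → Set
u ≼ v = Pointwise B._≤_ u v

ham : ∀ {n} → Word n → Word n → ℕ
ham [] [] = 0
ham (false ∷ u) (false ∷ v) = ham u v
ham (true ∷ u) (true ∷ v) = ham u v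
ham (false ∷ u) (true ∷ v) = suc (ham u v)
ham (true ∷ u) (false ∷ v) = suc (ham u v)

QAdj : ∀ {n} → Word n → Word n → Set
QAdj u v = ham u v ≡ 1

V : ∀ {n} → List (Word n) → Word n → Set
V X u = ∃[ x ] (x ∈ X × u ≼ x)

E : ∀ {n} → List (Word n) → Word n → Word n → Set
E X u v = V X u × V X v × QAdj u v

data Walk {n} (X : List (Word n)) : Word n → Word n → ℕ → Set where
  here : ∀ {u} → V X u → Walk X u u 0
  step : ∀ {u w v k} → E X u w → Walk X w v k → Walk X u v (suc k)

IsDist : ∀ {n} → List (Word n) → Word n → Word n → ℕ → Set
IsDist X u v k = Walk X u v k × (∀ {m} → Walk X u v m → k Data.Nat.≤ m)

W : ∀ {n} → List (Word n) → Word n → Word n → Word n → Set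
W X a b w = V X w × ∃[ k ] ∃[ l ] (IsDist X a w k × IsDist X b w l × k < l)

U : ∀ {n} → List (Word n) → Word n → Word n → Word n → Set
U X a b u = W X a b u × ∃[ y ] (W X b a y × E X u y)

IsLeSubgraph : ∀ {n} → List (Word n) → (Word n → Set) → Set
IsLeSubgraph X S = ∀ u → S u ⇔ (V X u × ∃[ v ] (S v × u ≼ v))

-- A daisy cube is closed downwards, so between any two of its
-- vertices there is a walk of Hamming length staying below one of the two
-- endpoints; hence the graph distance of G is the Hamming distance.  Flipping
-- position i changes the Hamming distance to w by exactly one, in a direction
-- dictated by w_i, so W_ab = {w ∈ V(G) : w_i = 0} and W_ba = {w ∈ V(G) : w_i = 1}.
-- Consequently the only F_ab-edge at u ∈ W_ab goes to u with bit i set, i.e.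
-- U_ab = {u ∈ V(G) : u_i = 0 and u[i]≔1 ∈ V(G)}, and this set is visibly
-- closed downwards, which is exactly the ≤-subgraph property.
module Submission where

open import Defs
open import Data.Nat using (ℕ; zero; suc; _+_; _≤_; _<_; z≤n; s≤s)
open import Data.Nat.Properties
  using (+-suc; +-monoʳ-≤; ≤-trans; ≤-reflexive; ≤-antisym; n≤1+n; m≤n⇒m≤1+n; <-asym; suc-injective)
open import Data.Bool using (true; false; f≤t; b≤b)
import Data.Bool.Properties as Boolₚ
open import Data.Fin using (Fin; zero; suc)
open import Data.Vec using (_∷_; []; lookup; _[_]≔_)
open import Data.Vec.Relation.Binary.Pointwise.Inductive as Pointwise using (_∷_)
open import Data.List using (List)
open import Data.Product using (_×_; _,_; proj₁; proj₂; ∃-syntax)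
open import Data.Sum using (_⊎_; inj₁; inj₂)
open import Data.Empty using (⊥; ⊥-elim)
open import Relation.Binary.PropositionalEquality using (_≡_; refl; sym; trans; cong; subst; subst₂)
open import Function.Bundles using (_⇔_; mk⇔; Equivalence)

private
  variable
    n : ℕ

ham-refl : (u : Word n) → ham u u ≡ 0
ham-refl [] = refl
ham-refl (false ∷ u) = ham-refl u
ham-refl (true ∷ u) = ham-refl u

ham-zero⇒≡ : (u v : Word n) → ham u v ≡ 0 → u ≡ v
ham-zero⇒≡ [] [] _ = refl
ham-zero⇒≡ (false ∷ u) (false ∷ v) e = cong (false ∷_) (ham-zero⇒≡ u v e)
ham-zero⇒≡ (true ∷ u) (true ∷ v) e = cong (true ∷_) (ham-zero⇒≡ u v e)

-- Arithmetic for the triangle inequality when the heads of u, v, w differ: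
-- either only the second leg pays for a mismatched head, or both legs pay
-- while the direct route does not.
second-leg-pays : {x p q : ℕ} → x ≤ p + q → suc x ≤ p + suc q
second-leg-pays {p = p} {q} x≤p+q = ≤-trans (s≤s x≤p+q) (≤-reflexive (sym (+-suc p q)))

both-legs-pay : {x p q : ℕ} → x ≤ p + q → x ≤ suc p + suc q
both-legs-pay {p = p} x≤p+q = m≤n⇒m≤1+n (≤-trans x≤p+q (+-monoʳ-≤ p (n≤1+n _)))

ham-triangle : (u v w : Word n) → ham u w ≤ ham u v + ham v w
ham-triangle [] [] [] = z≤n
ham-triangle (false ∷ u) (false ∷ v) (false ∷ w) = ham-triangle u v w
ham-triangle (true ∷ u) (true ∷ v) (true ∷ w) = ham-triangle u v w
ham-triangle (false ∷ u) (true ∷ v) (true ∷ w) = s≤s (ham-triangle u v w)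
ham-triangle (true ∷ u) (false ∷ v) (false ∷ w) = s≤s (ham-triangle u v w)
ham-triangle (false ∷ u) (false ∷ v) (true ∷ w) = second-leg-pays (ham-triangle u v w)
ham-triangle (true ∷ u) (true ∷ v) (false ∷ w) = second-leg-pays (ham-triangle u v w)
ham-triangle (false ∷ u) (true ∷ v) (false ∷ w) = both-legs-pay (ham-triangle u v w)
ham-triangle (true ∷ u) (false ∷ v) (true ∷ w) = both-legs-pay (ham-triangle u v w)

≼-refl : (u : Word n) → u ≼ u
≼-refl u = Pointwise.refl Boolₚ.≤-refl

≼-trans : {u v w : Word n} → u ≼ v → v ≼ w → u ≼ w
≼-trans = Pointwise.trans Boolₚ.≤-trans

≼-set : {u v : Word n} → u ≼ v → (i : Fin n) → (u [ i ]≔ true) ≼ (v [ i ]≔ true)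
≼-set (_ ∷ u≼v) zero = b≤b ∷ u≼v
≼-set (h ∷ u≼v) (suc i) = h ∷ ≼-set u≼v i

≼-bit-false : {u v : Word n} → u ≼ v → (i : Fin n) → lookup v i ≡ false → lookup u i ≡ false
≼-bit-false (b≤b ∷ _) zero p = p
≼-bit-false (f≤t ∷ _) zero _ = refl
≼-bit-false (_ ∷ u≼v) (suc i) p = ≼-bit-false u≼v i p

ham-set : (u : Word n) (i : Fin n) → lookup u i ≡ false → ham u (u [ i ]≔ true) ≡ 1
ham-set (false ∷ u) zero _ = cong suc (ham-refl u)
ham-set (false ∷ u) (suc i) p = ham-set u i p
ham-set (true ∷ u) (suc i) p = ham-set u i p

lookup-set : (u : Word n) (i : Fin n) → lookup (u [ i ]≔ true) i ≡ true
lookup-set (x ∷ u) zero = refl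
lookup-set (x ∷ u) (suc i) = lookup-set u i

-- Conversely, a Q_n-neighbour of v that differs from v at position i is v
-- with bit i set.
-- If the heads already differ, the tails are equal and cannot differ at i.
equal-tails-clash : (v y : Word n) (i : Fin n) → ham v y ≡ 0 → lookup v i ≡ false → lookup y i ≡ true → ⊥
equal-tails-clash v y i e p q with ham-zero⇒≡ v y e
... | refl with trans (sym p) q
...   | ()

neighbour-at : (v y : Word n) (i : Fin n) → ham v y ≡ 1 →
  lookup v i ≡ false → lookup y i ≡ true → y ≡ v [ i ]≔ true
neighbour-at (false ∷ v) (true ∷ y) zero e _ _ = cong (true ∷_) (sym (ham-zero⇒≡ v y (suc-injective e)))
neighbour-at (false ∷ v) (false ∷ y) (suc i) e p q = cong (false ∷_) (neighbour-at v y i e p q)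
neighbour-at (true ∷ v) (true ∷ y) (suc i) e p q = cong (true ∷_) (neighbour-at v y i e p q)
neighbour-at (false ∷ v) (true ∷ y) (suc i) e p q = ⊥-elim (equal-tails-clash v y i (suc-injective e) p q)
neighbour-at (true ∷ v) (false ∷ y) (suc i) e p q = ⊥-elim (equal-tails-clash v y i (suc-injective e) p q)

V-down : {X : List (Word n)} {u v : Word n} → V X v → u ≼ v → V X u
V-down (x , x∈X , v≼x) u≼v = x , x∈X , ≼-trans u≼v v≼x

-- Distance in a daisy cube is Hamming distance.  A walk changes one bit per
-- step, so it is at least as long as the Hamming distance.
walk-length-≥-ham : {X : List (Word n)} {u v : Word n} {k : ℕ} → Walk X u v k → ham u v ≤ k
walk-length-≥-ham {u = u} (here _) = ≤-reflexive (ham-refl u)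
walk-length-≥-ham {u = u} {v} (step {w = w} {k = k} (_ , _ , uw) walk) =
  ≤-trans (ham-triangle u w v) (subst (λ d → d + ham w v ≤ suc k) (sym uw) (s≤s (walk-length-≥-ham walk)))

-- One step of a geodesic: from u there is a neighbour w one step closer to v
-- that lies below u or below v (and hence stays in any daisy cube containing
-- both).
geodesic-step : (u v : Word n) (k : ℕ) → ham u v ≡ suc k →
  ∃[ w ] (ham u w ≡ 1 × ham w v ≡ k × (w ≼ u ⊎ w ≼ v))
geodesic-step [] [] k ()
geodesic-step (false ∷ u) (false ∷ v) k e with geodesic-step u v k e
... | w , uw , wv , inj₁ w≼u = false ∷ w , uw , wv , inj₁ (b≤b ∷ w≼u)
... | w , uw , wv , inj₂ w≼v = false ∷ w , uw , wv , inj₂ (b≤b ∷ w≼v)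
geodesic-step (true ∷ u) (true ∷ v) k e with geodesic-step u v k e
... | w , uw , wv , inj₁ w≼u = true ∷ w , uw , wv , inj₁ (b≤b ∷ w≼u)
... | w , uw , wv , inj₂ w≼v = true ∷ w , uw , wv , inj₂ (b≤b ∷ w≼v)
geodesic-step (true ∷ u) (false ∷ v) k refl =
  false ∷ u , cong suc (ham-refl u) , refl , inj₁ (f≤t ∷ ≼-refl u)
geodesic-step (false ∷ u) (true ∷ v) zero e with ham-zero⇒≡ u v (suc-injective e)
... | refl = true ∷ u , cong suc (ham-refl u) , ham-refl u , inj₂ (≼-refl (true ∷ u))
geodesic-step (false ∷ u) (true ∷ v) (suc k) e with geodesic-step u v k (suc-injective e)
... | w , uw , wv , inj₁ w≼u = false ∷ w , uw , cong suc wv , inj₁ (b≤b ∷ w≼u)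
... | w , uw , wv , inj₂ w≼v = false ∷ w , uw , cong suc wv , inj₂ (f≤t ∷ w≼v)

geodesic : {X : List (Word n)} (k : ℕ) {u v : Word n} → ham u v ≡ k → V X u → V X v → Walk X u v k
geodesic zero {u} {v} e Vu Vv = subst (λ z → Walk _ u z 0) (ham-zero⇒≡ u v e) (here Vu)
geodesic (suc k) {u} {v} e Vu Vv with geodesic-step u v k e
... | w , uw , wv , inj₁ w≼u = step (Vu , V-down Vu w≼u , uw) (geodesic k wv (V-down Vu w≼u) Vv)
... | w , uw , wv , inj₂ w≼v = step (Vu , V-down Vv w≼v , uw) (geodesic k wv (V-down Vv w≼v) Vv)

isDist-ham : {X : List (Word n)} {u v : Word n} → V X u → V X v → IsDist X u v (ham u v)
isDist-ham Vu Vv = geodesic _ refl Vu Vv , walk-length-≥-ham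

isDist⇒ham : {X : List (Word n)} {u v : Word n} {k : ℕ} → V X u → V X v → IsDist X u v k → k ≡ ham u v
isDist⇒ham Vu Vv (walk , shortest) = ≤-antisym (shortest (geodesic _ refl Vu Vv)) (walk-length-≥-ham walk)

W⇔ham< : {X : List (Word n)} {a b w : Word n} → V X a → V X b →
  W X a b w ⇔ (V X w × ham a w < ham b w)
W⇔ham< {a = a} {b} {w} Va Vb = mk⇔ to from
  where
  to : W _ a b w → V _ w × ham a w < ham b w
  to (Vw , k , l , dk , dl , k<l) =
    Vw , subst₂ _<_ (isDist⇒ham Va Vw dk) (isDist⇒ham Vb Vw dl) k<l
  from : V _ w × ham a w < ham b w → W _ a b w
  from (Vw , a<b) = Vw , ham a w , ham b w , isDist-ham Va Vw , isDist-ham Vb Vw , a<b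

ham-set-bit0 : (a w : Word n) (i : Fin n) → lookup a i ≡ false → lookup w i ≡ false →
  ham (a [ i ]≔ true) w ≡ suc (ham a w)
ham-set-bit0 (false ∷ a) (false ∷ w) zero _ _ = refl
ham-set-bit0 (false ∷ a) (false ∷ w) (suc i) p q = ham-set-bit0 a w i p q
ham-set-bit0 (false ∷ a) (true ∷ w) (suc i) p q = cong suc (ham-set-bit0 a w i p q)
ham-set-bit0 (true ∷ a) (false ∷ w) (suc i) p q = cong suc (ham-set-bit0 a w i p q)
ham-set-bit0 (true ∷ a) (true ∷ w) (suc i) p q = ham-set-bit0 a w i p q

ham-set-bit1 : (a w : Word n) (i : Fin n) → lookup a i ≡ false → lookup w i ≡ true →
  ham a w ≡ suc (ham (a [ i ]≔ true) w)
ham-set-bit1 (false ∷ a) (true ∷ w) zero _ _ = refl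
ham-set-bit1 (false ∷ a) (false ∷ w) (suc i) p q = ham-set-bit1 a w i p q
ham-set-bit1 (false ∷ a) (true ∷ w) (suc i) p q = cong suc (ham-set-bit1 a w i p q)
ham-set-bit1 (true ∷ a) (false ∷ w) (suc i) p q = cong suc (ham-set-bit1 a w i p q)
ham-set-bit1 (true ∷ a) (true ∷ w) (suc i) p q = ham-set-bit1 a w i p q

module EdgeInDirection {n : ℕ} (X : List (Word n)) (a b : Word n) (i : Fin n)
  (a-i : lookup a i ≡ false) (b≡a+i : b ≡ a [ i ]≔ true) (Va : V X a) (Vb : V X b) where

  closer-to-a : (w : Word n) → lookup w i ≡ false → ham a w < ham b w
  closer-to-a w w-i = ≤-reflexive (sym (trans (cong (λ c → ham c w) b≡a+i) (ham-set-bit0 a w i a-i w-i)))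

  closer-to-b : (w : Word n) → lookup w i ≡ true → ham b w < ham a w
  closer-to-b w w-i = ≤-reflexive (sym (trans (ham-set-bit1 a w i a-i w-i) (cong (λ c → suc (ham c w)) (sym b≡a+i))))

  Wab-bit : (w : Word n) → W X a b w → lookup w i ≡ false
  Wab-bit w Ww with lookup w i in w-i
  ... | false = refl
  ... | true = ⊥-elim (<-asym (proj₂ (Equivalence.to (W⇔ham< Va Vb) Ww)) (closer-to-b w w-i))

  bit0-Wab : (w : Word n) → V X w → lookup w i ≡ false → W X a b w
  bit0-Wab w Vw w-i = Equivalence.from (W⇔ham< Va Vb) (Vw , closer-to-a w w-i)

  Wba-bit : (w : Word n) → W X b a w → lookup w i ≡ true
  Wba-bit w Ww with lookup w i in w-i
  ... | true = refl
  ... | false = ⊥-elim (<-asym (proj₂ (Equivalence.to (W⇔ham< Vb Va) Ww)) (closer-to-a w w-i))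

  bit1-Wba : (w : Word n) → V X w → lookup w i ≡ true → W X b a w
  bit1-Wba w Vw w-i = Equivalence.from (W⇔ham< Vb Va) (Vw , closer-to-b w w-i)

  Liftable : Word n → Set
  Liftable u = lookup u i ≡ false × V X (u [ i ]≔ true)

  U⇒Liftable : (u : Word n) → U X a b u → Liftable u
  U⇒Liftable u (Wu , y , Wy , (_ , Vy , uy)) = u-i , subst (V X) y≡u+i Vy
    where
    u-i : lookup u i ≡ false
    u-i = Wab-bit u Wu
    -- the F_ab-edge uy crosses direction i, so y is u with bit i set
    y≡u+i : y ≡ u [ i ]≔ true
    y≡u+i = neighbour-at u y i uy u-i (Wba-bit y Wy)

  Liftable⇒U : (u : Word n) → V X u → Liftable u → U X a b u
  Liftable⇒U u Vu (u-i , Vu⁺) =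
    bit0-Wab u Vu u-i , u [ i ]≔ true , bit1-Wba _ Vu⁺ (lookup-set u i) , Vu , Vu⁺ , ham-set u i u-i

  Liftable-down : {u v : Word n} → u ≼ v → Liftable v → Liftable u
  Liftable-down u≼v (v-i , Vv⁺) = ≼-bit-false u≼v i v-i , V-down Vv⁺ (≼-set u≼v i)

corollary2p6 : ∀ {n} (X : List (Word n)) (a b : Word n) (i : Fin n) →
    lookup a i ≡ false → b ≡ a [ i ]≔ true → E X a b →
    IsLeSubgraph X (U X a b)
corollary2p6 X a b i a-i b≡a+i (Va , Vb , _) u = mk⇔ into-down-closure from-down-closure
  where
  open EdgeInDirection X a b i a-i b≡a+i Va Vb

  into-down-closure : U X a b u → V X u × ∃[ v ] (U X a b v × u ≼ v)
  into-down-closure Uu = proj₁ (proj₁ Uu) , u , Uu , ≼-refl u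

  from-down-closure : V X u × ∃[ v ] (U X a b v × u ≼ v) → U X a b u
  from-down-closure (Vu , v , Uv , u≼v) = Liftable⇒U u Vu (Liftable-down u≼v (U⇒Liftable v Uv))
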